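{- Every $PM$-vector is a shellable $M$-vector; i.e., the degree sequence of any discrete polymatroid is the degree sequence of some $M$-shellable pure monomial order ideal.
   Context: A monomial order ideal $\Gamma$ on variables $x_1,\ldots,x_r$ is a set of monomials such that $u\in\Gamma$ and $v\mid u$ imply $v\in\Gamma$, ordered by divisibility; it is pure if all maximal elements have the same degree. Its degree sequence is $(h_0,h_1,\ldots)$ where $h_i$ is the number of monomials of degree $i$ in $\Gamma$. For a monomial $m$, $m_i$ is the exponent of $x_i$ in $m$. A discrete polymatroid is a pure monomial order ideal $\Gamma$ such that for any two maximal monomials $m,m'\in\Gamma$ and any index $i$ with $m_i>m'_i$, there is $j$ with $m_j<m'_j$ and $\frac{x_j}{x_i}m\in\Gamma$. A $PM$-vector is the degree sequence of some discrete polymatroid. An $M$-poset is a poset isomorphic to the set of monomials dividing a fixed monomial, ordered by divisibility; an interval $[x,y]$ of a poset is an $M$-interval if it is an $M$-poset. An $M$-shelling of a pure poset $P$ is a partition of $P$ into $M$-intervals $[x_1,y_1],\ldots,[x_n,y_n]$ with each $y_i$ maximal in $P$, together with an ordering of these intervals such that the union of any initial subsequence is an order ideal of $P$; $P$ is $M$-shellable if it has one. A shellable $M$-vector is the degree sequence of an $M$-shellable pure monomial order ideal. -}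

module Defs where

open import Data.Nat using (ℕ; suc; pred; _≤_; _<_; _≟_)
open import Data.Fin using (Fin)
open import Data.Vec using (Vec; lookup; updateAt; sum)
open import Data.List using (List; length; filter; take)
import Data.List as L
open import Data.List.Membership.Propositional using (_∈_)
open import Data.List.Relation.Unary.Unique.Propositional using (Unique)
open import Data.Product using (Σ; ∃; _×_; _,_; proj₁; proj₂; Σ-syntax; ∃-syntax)
open import Relation.Binary.PropositionalEquality using (_≡_)

-- A monomial in r variables x_1..x_r is its exponent vector.
Monomial : ℕ → Set
Monomial r = Vec ℕ r

_∣ₘ_ : ∀ {r} → Monomial r → Monomial r → Set
v ∣ₘ u = ∀ i → lookup v i ≤ lookup u i

deg : ∀ {r} → Monomial r → ℕ
deg = sum

-- A (finite) set of monomials, represented as a duplicate-free list.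
MonSet : ℕ → Set
MonSet r = List (Monomial r)

IsOrderIdeal : ∀ {r} → MonSet r → Set
IsOrderIdeal Γ = Unique Γ × (∀ u v → u ∈ Γ → v ∣ₘ u → v ∈ Γ)

IsMaximal : ∀ {r} → MonSet r → Monomial r → Set
IsMaximal Γ m = m ∈ Γ × (∀ u → u ∈ Γ → m ∣ₘ u → u ≡ m)

IsPure : ∀ {r} → MonSet r → Set
IsPure Γ = ∀ m m' → IsMaximal Γ m → IsMaximal Γ m' → deg m ≡ deg m'

degSeq : ∀ {r} → MonSet r → ℕ → ℕ
degSeq Γ i = length (filter (λ m → deg m ≟ i) Γ)

exch : ∀ {r} → Fin r → Fin r → Monomial r → Monomial r
exch i j m = updateAt (updateAt m i pred) j suc

IsDiscretePolymatroid : ∀ {r} → MonSet r → Set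
IsDiscretePolymatroid Γ =
  IsOrderIdeal Γ × IsPure Γ ×
  (∀ m m' → IsMaximal Γ m → IsMaximal Γ m' → ∀ i → lookup m' i < lookup m i →
     ∃[ j ] (lookup m j < lookup m' j × exch i j m ∈ Γ))

IsPMVector : (ℕ → ℕ) → Set
IsPMVector h = ∃[ r ] Σ[ Γ ∈ MonSet r ] (IsDiscretePolymatroid Γ × (∀ i → degSeq Γ i ≡ h i))

record OrderIso {r s} (P : Monomial r → Set) (Q : Monomial s → Set) : Set where
  field
    to    : Monomial r → Monomial s
    from  : Monomial s → Monomial r
    to∈   : ∀ a → P a → Q (to a)
    from∈ : ∀ b → Q b → P (from b)
    from∘to : ∀ a → P a → from (to a) ≡ a
    to∘from : ∀ b → Q b → to (from b) ≡ b
    mono    : ∀ a a' → P a → P a' → a ∣ₘ a' → to a ∣ₘ to a'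
    reflect : ∀ a a' → P a → P a' → to a ∣ₘ to a' → a ∣ₘ a'

IsMPoset : ∀ {r} → (Monomial r → Set) → Set
IsMPoset P = ∃[ s ] Σ[ z ∈ Monomial s ] OrderIso (λ v → v ∣ₘ z) P

InInterval : ∀ {r} → MonSet r → Monomial r × Monomial r → Monomial r → Set
InInterval Γ (x , y) u = u ∈ Γ × x ∣ₘ u × u ∣ₘ y

InUnion : ∀ {r} → MonSet r → List (Monomial r × Monomial r) → Monomial r → Set
InUnion Γ Is u = ∃[ k ] InInterval Γ (L.lookup Is k) u

IsMShelling : ∀ {r} → MonSet r → List (Monomial r × Monomial r) → Set
IsMShelling Γ Is =
  (∀ k → let xy = L.lookup Is k in
         proj₁ xy ∈ Γ × IsMaximal Γ (proj₂ xy)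
         × proj₁ xy ∣ₘ proj₂ xy
         × IsMPoset (InInterval Γ xy)) ×
  (∀ u → u ∈ Γ → ∃[ k ] (InInterval Γ (L.lookup Is k) u ×
                         (∀ k' → InInterval Γ (L.lookup Is k') u → k' ≡ k))) ×
  (∀ n u v → InUnion Γ (take n Is) u → v ∈ Γ → v ∣ₘ u → InUnion Γ (take n Is) v)

IsMShellable : ∀ {r} → MonSet r → Set
IsMShellable Γ = Σ[ Is ∈ List (Monomial _ × Monomial _) ] IsMShelling Γ Is

IsShellableMVector : (ℕ → ℕ) → Set
IsShellableMVector h =
  ∃[ r ] Σ[ Γ ∈ MonSet r ] (IsOrderIdeal Γ × IsPure Γ × IsMShellable Γ × (∀ i → degSeq Γ i ≡ h i))

module Submission where

-- Every PM-vector is a shellable M-vector, because every discrete polymatroid Γ is itself an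
-- M-shellable pure order ideal, with the same degree sequence.
--
-- For u ∈ Γ let its lexicographic top be the lex-largest element of Γ divisible by u; it is a
-- maximal element of Γ.  The fiber of a maximal y (all u with top y) is closed under gcd: if b ∈ Γ
-- lay above gcd(u, v) with y <ₗ b, splicing y into u and v at the first coordinate i where y and b
-- differ and applying the exchange form of submodularity (raise-gcd, derived from augmentation,
-- which in turn comes from the basis exchange axiom) would put a monomial lex-above y over u or v
-- into Γ.  Hence each fiber is an interval [bottom y, y] of Γ, and intervals of order ideals are
-- M-posets.  Listing the maximal elements in decreasing lexicographic order gives the shelling:
-- a divisor v of u has a lexicographic top at least that of u, so initial unions are order ideals.

open import Defs
open import Data.Nat using (ℕ; zero; suc; pred; _+_; _∸_; _≤_; _<_; _≟_; _≤?_; _<?_; z≤n; s≤s; _⊓_)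
open import Data.Nat.Properties
open import Data.Fin using (Fin; zero; suc; toℕ)
import Data.Fin.Properties as Fin
open import Data.Vec using ([]; _∷_; lookup; updateAt; zipWith; tabulate)
import Data.Vec.Properties as Vec
open import Data.Vec.Relation.Binary.Lex.Strict as Lex using (Lex-<; this; next)
open import Data.List using (List; []; _∷_; length; filter; take)
import Data.List as List
open import Data.List.Membership.Propositional using (_∈_; _∉_)
open import Data.List.Relation.Unary.Any as Any using (here; there)
open import Data.List.Relation.Unary.Any.Properties using (lookup-index)
open import Data.List.Relation.Unary.All as All using (All; []; _∷_)
open import Data.List.Relation.Unary.AllPairs using (AllPairs; []; _∷_)
import Data.List.Relation.Unary.AllPairs.Properties as AllPairs
open import Data.List.Membership.Propositional.Properties using (∈-lookup; ∈-filter⁺; ∈-filter⁻; ∈-map⁺; ∈-map⁻)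
open import Data.Product using (Σ; _×_; _,_; proj₁; proj₂; ∃-syntax)
open import Data.Sum using (_⊎_; inj₁; inj₂)
open import Data.Empty using (⊥; ⊥-elim)
open import Relation.Nullary using (¬_; Dec; yes; no)
open import Relation.Nullary.Decidable using (_×-dec_; _→-dec_; ¬?; map′)
open import Relation.Binary using (StrictTotalOrder; Tri; tri<; tri≈; tri>)
open import Data.Vec.Relation.Binary.Pointwise.Inductive using (Pointwise-≡⇒≡; ≡⇒Pointwise-≡)
open import Relation.Binary.PropositionalEquality
open import Algebra.Properties.CommutativeSemigroup +-commutativeSemigroup using (interchange)

≡-pointwise : ∀ {r} {u v : Monomial r} → (∀ i → lookup u i ≡ lookup v i) → u ≡ v
≡-pointwise {u = u} {v} p = begin
  u                   ≡⟨ Vec.tabulate∘lookup u ⟨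
  tabulate (lookup u) ≡⟨ Vec.tabulate-cong p ⟩
  tabulate (lookup v) ≡⟨ Vec.tabulate∘lookup v ⟩
  v                   ∎
  where open ≡-Reasoning

∣ₘ-refl : ∀ {r} (u : Monomial r) → u ∣ₘ u
∣ₘ-refl u i = ≤-refl

∣ₘ-antisym : ∀ {r} {u v : Monomial r} → u ∣ₘ v → v ∣ₘ u → u ≡ v
∣ₘ-antisym p q = ≡-pointwise λ i → ≤-antisym (p i) (q i)

_∣ₘ?_ : ∀ {r} (u v : Monomial r) → Dec (u ∣ₘ v)
u ∣ₘ? v = Fin.all? (λ i → lookup u i ≤? lookup v i)

deg-mono : ∀ {r} (u v : Monomial r) → u ∣ₘ v → deg u ≤ deg v
deg-mono [] [] p = z≤n
deg-mono (a ∷ u) (b ∷ v) p = +-mono-≤ (p zero) (deg-mono u v (λ i → p (suc i)))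

deg-strict : ∀ {r} (u v : Monomial r) → u ∣ₘ v → ∀ k → lookup u k < lookup v k → deg u < deg v
deg-strict (a ∷ u) (b ∷ v) p zero lt = +-mono-<-≤ lt (deg-mono u v (λ i → p (suc i)))
deg-strict (a ∷ u) (b ∷ v) p (suc k) lt = +-mono-≤-< (p zero) (deg-strict u v (λ i → p (suc i)) k lt)

divisor-of-degree : ∀ {r} (u v : Monomial r) → u ∣ₘ v → deg v ≤ deg u → u ≡ v
divisor-of-degree u v p dv = ≡-pointwise λ i →
  ≤-antisym (p i) (≮⇒≥ λ lt → <⇒≱ (deg-strict u v p i lt) dv)

deg-+-mono : ∀ {r} (a b c e : Monomial r) →
  (∀ k → lookup a k + lookup b k ≤ lookup c k + lookup e k) → deg a + deg b ≤ deg c + deg e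
deg-+-mono [] [] [] [] p = z≤n
deg-+-mono (x ∷ a) (y ∷ b) (z ∷ c) (w ∷ e) p = begin
  (x + deg a) + (y + deg b) ≡⟨ interchange x (deg a) y (deg b) ⟩
  (x + y) + (deg a + deg b) ≤⟨ +-mono-≤ (p zero) (deg-+-mono a b c e (λ k → p (suc k))) ⟩
  (z + w) + (deg c + deg e) ≡⟨ interchange z w (deg c) (deg e) ⟩
  (z + deg c) + (w + deg e) ∎
  where open ≤-Reasoning

infixl 30 _∧ₘ_ _/ₘ_ _*ₘ_
_∧ₘ_ : ∀ {r} → Monomial r → Monomial r → Monomial r
_∧ₘ_ = zipWith _⊓_

_/ₘ_ : ∀ {r} → Monomial r → Monomial r → Monomial r
_/ₘ_ = zipWith _∸_

_*ₘ_ : ∀ {r} → Monomial r → Monomial r → Monomial r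
_*ₘ_ = zipWith _+_

infixr 30 x[_]*_
x[_]*_ : ∀ {r} → Fin r → Monomial r → Monomial r
x[ i ]* m = updateAt m i suc

x*-here : ∀ {r} i (m : Monomial r) → lookup (x[ i ]* m) i ≡ suc (lookup m i)
x*-here i m = Vec.lookup∘updateAt i m

x*-there : ∀ {r} {i k} (m : Monomial r) → i ≢ k → lookup (x[ i ]* m) k ≡ lookup m k
x*-there {i = i} {k} m i≢k = Vec.lookup∘updateAt′ k i (λ e → i≢k (sym e)) m

deg-x* : ∀ {r} i (m : Monomial r) → deg (x[ i ]* m) ≡ suc (deg m)
deg-x* zero (a ∷ m) = refl
deg-x* (suc i) (a ∷ m) = trans (cong (a +_) (deg-x* i m)) (+-suc a (deg m))

∣-x* : ∀ {r} i (m : Monomial r) → m ∣ₘ x[ i ]* m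
∣-x* i m k with i Fin.≟ k
... | yes refl = subst (lookup m i ≤_) (sym (x*-here i m)) (n≤1+n _)
... | no i≢k = ≤-reflexive (sym (x*-there m i≢k))

x*-∣ : ∀ {r} i (m v : Monomial r) → lookup m i < lookup v i →
  (∀ k → i ≢ k → lookup m k ≤ lookup v k) → x[ i ]* m ∣ₘ v
x*-∣ i m v mᵢ<vᵢ others k with i Fin.≟ k
... | yes refl = subst (_≤ lookup v i) (sym (x*-here i m)) mᵢ<vᵢ
... | no i≢k = subst (_≤ lookup v k) (sym (x*-there m i≢k)) (others k i≢k)

x*-mono : ∀ {r} i (u v : Monomial r) → u ∣ₘ v → x[ i ]* u ∣ₘ x[ i ]* v
x*-mono i u v p = x*-∣ i u (x[ i ]* v) (subst (lookup u i <_) (sym (x*-here i v)) (s≤s (p i)))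
  (λ k i≢k → subst (lookup u k ≤_) (sym (x*-there v i≢k)) (p k))

exch-l : ∀ {r} {l j} (m : Monomial r) → l ≢ j → lookup (exch l j m) l ≡ pred (lookup m l)
exch-l {l = l} m l≢j = trans (x*-there (updateAt m l pred) (λ e → l≢j (sym e))) (Vec.lookup∘updateAt l m)

exch-j : ∀ {r} {l j} (m : Monomial r) → l ≢ j → lookup (exch l j m) j ≡ suc (lookup m j)
exch-j {l = l} {j} m l≢j =
  trans (x*-here j (updateAt m l pred)) (cong suc (Vec.lookup∘updateAt′ j l (λ e → l≢j (sym e)) m))

exch-other : ∀ {r} {l j k} (m : Monomial r) → l ≢ k → j ≢ k → lookup (exch l j m) k ≡ lookup m k
exch-other {l = l} {k = k} m l≢k j≢k =
  trans (x*-there (updateAt m l pred) j≢k) (Vec.lookup∘updateAt′ k l (λ e → l≢k (sym e)) m)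

deg-pred : ∀ {r} (m : Monomial r) l → 0 < lookup m l → suc (deg (updateAt m l pred)) ≡ deg m
deg-pred (suc a ∷ m) zero _ = refl
deg-pred (a ∷ m) (suc l) pos = trans (sym (+-suc a _)) (cong (a +_) (deg-pred m l pos))

deg-exch : ∀ {r} (m : Monomial r) l j → 0 < lookup m l → deg (exch l j m) ≡ deg m
deg-exch m l j pos = trans (deg-x* j (updateAt m l pred)) (deg-pred m l pos)

_<ₗ_ : ∀ {r} → Monomial r → Monomial r → Set
_<ₗ_ = Lex-< _≡_ _<_

module LexOrder {r} = StrictTotalOrder (Lex.<-strictTotalOrder <-strictTotalOrder r)

<ₗ-irrefl : ∀ {r} (u : Monomial r) → ¬ u <ₗ u
<ₗ-irrefl u = LexOrder.irrefl LexOrder.Eq.refl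

<ₗ-compare : ∀ {r} (u v : Monomial r) → Tri (u <ₗ v) (u ≡ v) (v <ₗ u)
<ₗ-compare u v with LexOrder.compare u v
... | tri< u<v u≢v u≯v = tri< u<v (λ u≡v → u≢v (≡⇒Pointwise-≡ u≡v)) u≯v
... | tri≈ u≮v u≈v u≯v = tri≈ u≮v (Pointwise-≡⇒≡ u≈v) u≯v
... | tri> u≮v u≢v u>v = tri> u≮v (λ u≡v → u≢v (≡⇒Pointwise-≡ u≡v)) u>v

<ₗ-first-difference : ∀ {r} {y b : Monomial r} → y <ₗ b →
  Σ (Fin r) λ i → (∀ k → toℕ k < toℕ i → lookup y k ≡ lookup b k) × lookup y i < lookup b i
<ₗ-first-difference (this lt _) = zero , (λ k ()) , lt
<ₗ-first-difference {y = a ∷ y} {c ∷ b} (next a≡c y<b) with <ₗ-first-difference y<b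
... | i , agree , lt = suc i , agree′ , lt
  where
  agree′ : ∀ k → toℕ k < toℕ (suc i) → lookup (a ∷ y) k ≡ lookup (c ∷ b) k
  agree′ zero _ = a≡c
  agree′ (suc k) (s≤s k<i) = agree k k<i

<ₗ-from-difference : ∀ {r} (y b : Monomial r) i → (∀ k → toℕ k < toℕ i → lookup y k ≤ lookup b k) →
  lookup y i < lookup b i → y <ₗ b
<ₗ-from-difference (a ∷ y) (c ∷ b) zero below lt = this lt refl
<ₗ-from-difference (a ∷ y) (c ∷ b) (suc i) below lt with m≤n⇒m<n∨m≡n (below zero (s≤s z≤n))
... | inj₁ a<c = this a<c refl
... | inj₂ a≡c = next a≡c (<ₗ-from-difference y b i (λ k k<i → below (suc k) (s≤s k<i)) lt)

∣ₘ⇒≤ₗ : ∀ {r} (u v : Monomial r) → u ∣ₘ v → u <ₗ v ⊎ u ≡ v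
∣ₘ⇒≤ₗ [] [] p = inj₂ refl
∣ₘ⇒≤ₗ (a ∷ u) (b ∷ v) p with m≤n⇒m<n∨m≡n (p zero) | ∣ₘ⇒≤ₗ u v (λ i → p (suc i))
... | inj₁ a<b | _ = inj₁ (this a<b refl)
... | inj₂ refl | inj₁ u<v = inj₁ (next refl u<v)
... | inj₂ refl | inj₂ refl = inj₂ refl

module _ {a ℓ₁ ℓ₂} (O : StrictTotalOrder a ℓ₁ ℓ₂) where
  open StrictTotalOrder O using (module Eq; irrefl; asym; compare)
    renaming (Carrier to A; _<_ to _≺_; trans to ≺-trans)

  maximum : ∀ {p} {P : A → Set p} → (∀ x → Dec (P x)) → (xs : List A) →
    (∀ x → x ∈ xs → ¬ P x) ⊎ (Σ A λ y → y ∈ xs × P y × (∀ z → z ∈ xs → P z → ¬ y ≺ z))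
  maximum P? [] = inj₁ (λ x ())
  maximum P? (x ∷ xs) with maximum P? xs | P? x
  ... | inj₁ none | no ¬Px = inj₁ λ { _ (here refl) → ¬Px ; z (there z∈) → none z z∈ }
  ... | inj₁ none | yes Px = inj₂ (x , here refl , Px , λ
    { _ (here refl) _ → irrefl Eq.refl
    ; z (there z∈) Pz → ⊥-elim (none z z∈ Pz) })
  ... | inj₂ (y , y∈ , Py , top) | no ¬Px = inj₂ (y , there y∈ , Py , λ
    { _ (here refl) Px → ⊥-elim (¬Px Px)
    ; z (there z∈) → top z z∈ })
  ... | inj₂ (y , y∈ , Py , top) | yes Px with compare y x
  ...   | tri< y<x _ _ = inj₂ (x , here refl , Px , λ
    { _ (here refl) _ → irrefl Eq.refl
    ; z (there z∈) Pz x<z → top z z∈ Pz (≺-trans y<x x<z) })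
  ...   | tri≈ _ y≈x _ = inj₂ (y , there y∈ , Py , λ
    { _ (here refl) _ → irrefl y≈x
    ; z (there z∈) → top z z∈ })
  ...   | tri> _ _ x<y = inj₂ (y , there y∈ , Py , λ
    { _ (here refl) _ y<x → asym y<x x<y
    ; z (there z∈) → top z z∈ })

∧ₘ-∣ˡ : ∀ {r} (u v : Monomial r) → u ∧ₘ v ∣ₘ u
∧ₘ-∣ˡ u v k = subst (_≤ lookup u k) (sym (Vec.lookup-zipWith _⊓_ k u v)) (m⊓n≤m _ _)

∧ₘ-∣ʳ : ∀ {r} (u v : Monomial r) → u ∧ₘ v ∣ₘ v
∧ₘ-∣ʳ u v k = subst (_≤ lookup v k) (sym (Vec.lookup-zipWith _⊓_ k u v)) (m⊓n≤n _ _)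

gcd-all : ∀ {r} → Monomial r → List (Monomial r) → Monomial r
gcd-all y = List.foldr _∧ₘ_ y

gcd-all-∣ : ∀ {r} (y : Monomial r) {xs u} → u ∈ xs → gcd-all y xs ∣ₘ u
gcd-all-∣ y {x ∷ xs} (here refl) = ∧ₘ-∣ˡ x (gcd-all y xs)
gcd-all-∣ y {x ∷ xs} (there u∈) k = ≤-trans (∧ₘ-∣ʳ x (gcd-all y xs) k) (gcd-all-∣ y u∈ k)

stuck-degree-bound : ∀ {r} (c c′ β β′ : Monomial r) → c ∣ₘ β → c′ ∣ₘ β′ →
  (∀ k → lookup c k < lookup β k → lookup c′ k ≤ lookup c k × lookup β k ≤ lookup β′ k) →
  deg c′ + deg β ≤ deg c + deg β′
stuck-degree-bound c c′ β β′ c∣β c′∣β′ stuck = deg-+-mono c′ β c β′ coordinate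
  where
  coordinate : ∀ k → lookup c′ k + lookup β k ≤ lookup c k + lookup β′ k
  coordinate k with m≤n⇒m<n∨m≡n (c∣β k)
  ... | inj₁ cₖ<βₖ = +-mono-≤ (proj₁ (stuck k cₖ<βₖ)) (proj₂ (stuck k cₖ<βₖ))
  ... | inj₂ cₖ≡βₖ = begin
    lookup c′ k + lookup β k  ≡⟨ +-comm (lookup c′ k) _ ⟩
    lookup β k + lookup c′ k  ≤⟨ +-mono-≤ (≤-reflexive (sym cₖ≡βₖ)) (c′∣β′ k) ⟩
    lookup c k + lookup β′ k  ∎
    where open ≤-Reasoning

almost-equal : ∀ {r} (u v : Monomial r) → u ∣ₘ v → deg v ≤ suc (deg u) →
  v ∣ₘ u ⊎ Σ (Fin r) λ k → ∀ j → k ≢ j → lookup v j ≤ lookup u j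
almost-equal u v u∣v dv with Fin.any? (λ k → lookup u k <? lookup v k)
... | no none = inj₁ λ k → ≮⇒≥ λ uₖ<vₖ → none (k , uₖ<vₖ)
... | yes (k , uₖ<vₖ) = inj₂ (k , λ j k≢j → ≮⇒≥ λ uⱼ<vⱼ → <⇒≱ (too-large j k≢j uⱼ<vⱼ) dv)
  where
  xₖu∣v : x[ k ]* u ∣ₘ v
  xₖu∣v = x*-∣ k u v uₖ<vₖ (λ j _ → u∣v j)
  too-large : ∀ j → k ≢ j → lookup u j < lookup v j → suc (deg u) < deg v
  too-large j k≢j uⱼ<vⱼ = subst (_< deg v) (deg-x* k u)
    (deg-strict (x[ k ]* u) v xₖu∣v j (subst (_< lookup v j) (sym (x*-there u k≢j)) uⱼ<vⱼ))

splice-coordinate : ∀ {r} → Monomial r → Fin r → Monomial r → Fin r → ℕ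
splice-coordinate y i u k with toℕ k ≤? toℕ i
... | yes _ = lookup y k
... | no _ = lookup u k

splice : ∀ {r} → Monomial r → Fin r → Monomial r → Monomial r
splice y i u = tabulate (splice-coordinate y i u)

splice-≤ : ∀ {r} (y : Monomial r) i u k → toℕ k ≤ toℕ i → lookup (splice y i u) k ≡ lookup y k
splice-≤ y i u k k≤i rewrite Vec.lookup∘tabulate (splice-coordinate y i u) k with toℕ k ≤? toℕ i
... | yes _ = refl
... | no k≰i = ⊥-elim (k≰i k≤i)

splice-> : ∀ {r} (y : Monomial r) i u k → ¬ toℕ k ≤ toℕ i → lookup (splice y i u) k ≡ lookup u k
splice-> y i u k k≰i rewrite Vec.lookup∘tabulate (splice-coordinate y i u) k with toℕ k ≤? toℕ i
... | yes k≤i = ⊥-elim (k≰i k≤i)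
... | no _ = refl

splice-∣ : ∀ {r} {y u : Monomial r} i → u ∣ₘ y → splice y i u ∣ₘ y
splice-∣ {y = y} {u} i u∣y k with toℕ k ≤? toℕ i
... | yes k≤i = ≤-reflexive (splice-≤ y i u k k≤i)
... | no k≰i = subst (_≤ lookup y k) (sym (splice-> y i u k k≰i)) (u∣y k)

∣-splice : ∀ {r} {y u : Monomial r} i → u ∣ₘ y → u ∣ₘ splice y i u
∣-splice {y = y} {u} i u∣y k with toℕ k ≤? toℕ i
... | yes k≤i = subst (lookup u k ≤_) (sym (splice-≤ y i u k k≤i)) (u∣y k)
... | no k≰i = ≤-reflexive (sym (splice-> y i u k k≰i))

<ₗ-x*-splice : ∀ {r} (y : Monomial r) i u → y <ₗ x[ i ]* splice y i u
<ₗ-x*-splice y i u = <ₗ-from-difference y (x[ i ]* splice y i u) i agree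
  (subst (lookup y i <_) (sym (trans (x*-here i (splice y i u)) (cong suc (splice-≤ y i u i ≤-refl)))) ≤-refl)
  where
  agree : ∀ k → toℕ k < toℕ i → lookup y k ≤ lookup (x[ i ]* splice y i u) k
  agree k k<i = ≤-reflexive (sym (trans (x*-there (splice y i u) i≢k) (splice-≤ y i u k (<⇒≤ k<i))))
    where
    i≢k : i ≢ k
    i≢k refl = <-irrefl refl k<i

splice-gcd : ∀ {r} (y : Monomial r) i u v → splice y i u ∧ₘ splice y i v ≡ splice y i (u ∧ₘ v)
splice-gcd y i u v = ≡-pointwise coordinate
  where
  coordinate : ∀ k → lookup (splice y i u ∧ₘ splice y i v) k ≡ lookup (splice y i (u ∧ₘ v)) k
  coordinate k rewrite Vec.lookup-zipWith _⊓_ k (splice y i u) (splice y i v) with toℕ k ≤? toℕ i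
  ... | yes k≤i rewrite splice-≤ y i u k k≤i | splice-≤ y i v k k≤i | splice-≤ y i (u ∧ₘ v) k k≤i = ⊓-idem _
  ... | no k≰i rewrite splice-> y i u k k≰i | splice-> y i v k k≰i | splice-> y i (u ∧ₘ v) k k≰i =
    sym (Vec.lookup-zipWith _⊓_ k u v)

raise-splice-∣ : ∀ {r} (y b : Monomial r) i w → (∀ k → toℕ k < toℕ i → lookup y k ≡ lookup b k) →
  lookup y i < lookup b i → w ∣ₘ b → x[ i ]* splice y i w ∣ₘ b
raise-splice-∣ y b i w agree yᵢ<bᵢ w∣b = x*-∣ i (splice y i w) b
  (subst (_< lookup b i) (sym (splice-≤ y i w i ≤-refl)) yᵢ<bᵢ) others
  where
  others : ∀ k → i ≢ k → lookup (splice y i w) k ≤ lookup b k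
  others k i≢k with toℕ k ≤? toℕ i
  ... | yes k≤i = ≤-reflexive (trans (splice-≤ y i w k k≤i)
                    (agree k (≤∧≢⇒< k≤i λ k≡i → i≢k (sym (Fin.toℕ-injective k≡i)))))
  ... | no k≰i = subst (_≤ lookup b k) (sym (splice-> y i w k k≰i)) (w∣b k)

-- Multiplication by x is an isomorphism from the divisors of y / x onto the interval [x, y]
-- of any order ideal Γ containing y (the isomorphism lies inside Γ since Γ is closed under division).
interval-isMPoset : ∀ {r} (Γ : MonSet r) → (∀ u v → u ∈ Γ → v ∣ₘ u → v ∈ Γ) →
  ∀ x {y} → y ∈ Γ → x ∣ₘ y → IsMPoset (InInterval Γ (x , y))
interval-isMPoset {r} Γ closed x {y} y∈ x∣y = r , y /ₘ x , record
  { to = _*ₘ x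
  ; from = _/ₘ x
  ; to∈ = λ v v∣y/x → let v*x∣y = *x-∣ v v∣y/x in closed y (v *ₘ x) y∈ v*x∣y , x∣*x v , v*x∣y
  ; from∈ = λ u (_ , _ , u∣y) k →
      subst₂ _≤_ (sym (lookup-/ u k)) (sym (lookup-/ y k)) (∸-monoˡ-≤ (lookup x k) (u∣y k))
  ; from∘to = λ v _ → ≡-pointwise λ k → trans (lookup-/ (v *ₘ x) k)
      (trans (cong (_∸ lookup x k) (lookup-* v k)) (m+n∸n≡m (lookup v k) (lookup x k)))
  ; to∘from = λ u (_ , x∣u , _) → ≡-pointwise λ k → trans (lookup-* (u /ₘ x) k)
      (trans (cong (_+ lookup x k) (lookup-/ u k)) (m∸n+n≡m (x∣u k)))
  ; mono = λ v v′ _ _ v∣v′ k →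
      subst₂ _≤_ (sym (lookup-* v k)) (sym (lookup-* v′ k)) (+-monoˡ-≤ (lookup x k) (v∣v′ k))
  ; reflect = λ v v′ _ _ vx∣v′x k →
      +-cancelʳ-≤ (lookup x k) _ _ (subst₂ _≤_ (lookup-* v k) (lookup-* v′ k) (vx∣v′x k))
  }
  where
  lookup-* : ∀ v k → lookup (v *ₘ x) k ≡ lookup v k + lookup x k
  lookup-* v k = Vec.lookup-zipWith _+_ k v x
  lookup-/ : ∀ v k → lookup (v /ₘ x) k ≡ lookup v k ∸ lookup x k
  lookup-/ v k = Vec.lookup-zipWith _∸_ k v x
  x∣*x : ∀ v → x ∣ₘ v *ₘ x
  x∣*x v k = subst (lookup x k ≤_) (sym (lookup-* v k)) (m≤n+m (lookup x k) (lookup v k))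
  *x-∣ : ∀ v → v ∣ₘ y /ₘ x → v *ₘ x ∣ₘ y
  *x-∣ v v∣y/x k = begin
    lookup (v *ₘ x) k         ≡⟨ lookup-* v k ⟩
    lookup v k + lookup x k   ≤⟨ +-monoˡ-≤ (lookup x k) (subst (lookup v k ≤_) (lookup-/ y k) (v∣y/x k)) ⟩
    lookup y k ∸ lookup x k + lookup x k ≡⟨ m∸n+n≡m (x∣y k) ⟩
    lookup y k                ∎
    where open ≤-Reasoning

AllPairs-lookup : ∀ {A : Set} {R : A → A → Set} {xs : List A} → AllPairs R xs →
  ∀ (i j : Fin (length xs)) → toℕ i < toℕ j → R (List.lookup xs i) (List.lookup xs j)
AllPairs-lookup (Rx ∷ _) zero (suc j) _ = All.lookup Rx (∈-lookup j)
AllPairs-lookup (_ ∷ pairs) (suc i) (suc j) (s≤s i<j) = AllPairs-lookup pairs i j i<j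

AllPairs-position : ∀ {A B : Set} {R : A → A → Set} {xs : List A} → AllPairs R xs → (f : A → B) →
  (∀ a b → R a b → f a ≢ f b) →
  ∀ (i j : Fin (length xs)) → f (List.lookup xs i) ≡ f (List.lookup xs j) → i ≡ j
AllPairs-position pairs f R⇒≢ i j same with <-cmp (toℕ i) (toℕ j)
... | tri< i<j _ _ = ⊥-elim (R⇒≢ _ _ (AllPairs-lookup pairs i j i<j) same)
... | tri≈ _ i≡j _ = Fin.toℕ-injective i≡j
... | tri> _ _ j<i = ⊥-elim (R⇒≢ _ _ (AllPairs-lookup pairs j i j<i) (sym same))

lookup-take⁻ : ∀ {A : Set} n (xs : List A) (k : Fin (length (take n xs))) →
  Σ (Fin (length xs)) λ k′ → toℕ k′ < n × List.lookup (take n xs) k ≡ List.lookup xs k′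
lookup-take⁻ (suc n) (x ∷ xs) zero = zero , s≤s z≤n , refl
lookup-take⁻ (suc n) (x ∷ xs) (suc k) with lookup-take⁻ n xs k
... | k′ , k′<n , same = suc k′ , s≤s k′<n , same

lookup-take⁺ : ∀ {A : Set} n (xs : List A) (k : Fin (length xs)) → toℕ k < n →
  Σ (Fin (length (take n xs))) λ k′ → List.lookup (take n xs) k′ ≡ List.lookup xs k
lookup-take⁺ (suc n) (x ∷ xs) zero _ = zero , refl
lookup-take⁺ (suc n) (x ∷ xs) (suc k) (s≤s k<n) with lookup-take⁺ n xs k k<n
... | k′ , same = suc k′ , same

Decreasing : ∀ {r} → List (Monomial r) → Set
Decreasing = AllPairs (λ a b → b <ₗ a)

insertDesc : ∀ {r} → Monomial r → List (Monomial r) → List (Monomial r)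
insertDesc x [] = x ∷ []
insertDesc x (a ∷ as) with <ₗ-compare a x
... | tri< _ _ _ = x ∷ a ∷ as
... | tri≈ _ _ _ = a ∷ as
... | tri> _ _ _ = a ∷ insertDesc x as

insertDesc-∈⁻ : ∀ {r} x (as : List (Monomial r)) {z} → z ∈ insertDesc x as → z ≡ x ⊎ z ∈ as
insertDesc-∈⁻ x [] (here z≡x) = inj₁ z≡x
insertDesc-∈⁻ x (a ∷ as) z∈ with <ₗ-compare a x | z∈
... | tri< _ _ _ | here z≡x = inj₁ z≡x
... | tri< _ _ _ | there z∈′ = inj₂ z∈′
... | tri≈ _ _ _ | z∈′ = inj₂ z∈′
... | tri> _ _ _ | here z≡a = inj₂ (here z≡a)
... | tri> _ _ _ | there z∈′ with insertDesc-∈⁻ x as z∈′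
...   | inj₁ z≡x = inj₁ z≡x
...   | inj₂ z∈as = inj₂ (there z∈as)

insertDesc-∈-self : ∀ {r} x (as : List (Monomial r)) → x ∈ insertDesc x as
insertDesc-∈-self x [] = here refl
insertDesc-∈-self x (a ∷ as) with <ₗ-compare a x
... | tri< _ _ _ = here refl
... | tri≈ _ a≡x _ = here (sym a≡x)
... | tri> _ _ _ = there (insertDesc-∈-self x as)

insertDesc-∈⁺ : ∀ {r} x (as : List (Monomial r)) {z} → z ∈ as → z ∈ insertDesc x as
insertDesc-∈⁺ x (a ∷ as) z∈ with <ₗ-compare a x | z∈
... | tri< _ _ _ | _ = there z∈
... | tri≈ _ _ _ | _ = z∈
... | tri> _ _ _ | here z≡a = here z≡a
... | tri> _ _ _ | there z∈′ = there (insertDesc-∈⁺ x as z∈′)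

insertDesc-decreasing : ∀ {r} x (as : List (Monomial r)) → Decreasing as → Decreasing (insertDesc x as)
insertDesc-decreasing x [] [] = [] ∷ []
insertDesc-decreasing x (a ∷ as) (a>as ∷ dec) with <ₗ-compare a x
... | tri< a<x _ _ = (a<x ∷ All.map (λ b<a → LexOrder.trans b<a a<x) a>as) ∷ a>as ∷ dec
... | tri≈ _ _ _ = a>as ∷ dec
... | tri> _ _ x<a = All.tabulate below-a ∷ insertDesc-decreasing x as dec
  where
  below-a : ∀ {z} → z ∈ insertDesc x as → z <ₗ a
  below-a z∈ with insertDesc-∈⁻ x as z∈
  ... | inj₁ refl = x<a
  ... | inj₂ z∈as = All.lookup a>as z∈as

sortDesc : ∀ {r} → List (Monomial r) → List (Monomial r)
sortDesc = List.foldr insertDesc []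

sortDesc-∈⁻ : ∀ {r} (xs : List (Monomial r)) {z} → z ∈ sortDesc xs → z ∈ xs
sortDesc-∈⁻ (x ∷ xs) z∈ with insertDesc-∈⁻ x (sortDesc xs) z∈
... | inj₁ refl = here refl
... | inj₂ z∈′ = there (sortDesc-∈⁻ xs z∈′)

sortDesc-∈⁺ : ∀ {r} (xs : List (Monomial r)) {z} → z ∈ xs → z ∈ sortDesc xs
sortDesc-∈⁺ (x ∷ xs) (here refl) = insertDesc-∈-self x (sortDesc xs)
sortDesc-∈⁺ (x ∷ xs) (there z∈) = insertDesc-∈⁺ x (sortDesc xs) (sortDesc-∈⁺ xs z∈)

sortDesc-decreasing : ∀ {r} (xs : List (Monomial r)) → Decreasing (sortDesc xs)
sortDesc-decreasing [] = []
sortDesc-decreasing (x ∷ xs) = insertDesc-decreasing x (sortDesc xs) (sortDesc-decreasing xs)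

module Polymatroid {r} (Γ : MonSet r)
  (closed : ∀ u v → u ∈ Γ → v ∣ₘ u → v ∈ Γ)
  (pure : IsPure Γ)
  (exchange : ∀ m m′ → IsMaximal Γ m → IsMaximal Γ m′ → ∀ i → lookup m′ i < lookup m i →
     ∃[ j ] (lookup m j < lookup m′ j × exch i j m ∈ Γ)) where

  down : ∀ {u v} → u ∈ Γ → v ∣ₘ u → v ∈ Γ
  down {u} {v} = closed u v

  IsLexTop : Monomial r → Monomial r → Set
  IsLexTop y u = u ∈ Γ × u ∣ₘ y × (∀ b → b ∈ Γ → u ∣ₘ b → ¬ y <ₗ b)

  lexTop : ∀ {u} → u ∈ Γ → Σ (Monomial r) λ y → y ∈ Γ × IsLexTop y u
  lexTop {u} u∈ with maximum (Lex.<-strictTotalOrder <-strictTotalOrder r) (u ∣ₘ?_) Γ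
  ... | inj₁ none = ⊥-elim (none u u∈ (∣ₘ-refl u))
  ... | inj₂ (y , y∈ , u∣y , highest) = y , y∈ , u∈ , u∣y , highest

  -- Since divisibility refines the lexicographic order, a lexicographic top is maximal in Γ.
  lexTop-maximal : ∀ {y u} → y ∈ Γ → IsLexTop y u → IsMaximal Γ y
  lexTop-maximal {y} y∈ (_ , u∣y , highest) = y∈ , above
    where
    above : ∀ v → v ∈ Γ → y ∣ₘ v → v ≡ y
    above v v∈ y∣v with ∣ₘ⇒≤ₗ y v y∣v
    ... | inj₁ y<v = ⊥-elim (highest v v∈ (λ k → ≤-trans (u∣y k) (y∣v k)) y<v)
    ... | inj₂ y≡v = sym y≡v

  maximal-lexTop : ∀ {y} → IsMaximal Γ y → IsLexTop y y
  maximal-lexTop {y} (y∈ , maximal) = y∈ , ∣ₘ-refl y ,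
    λ b b∈ y∣b y<b → <ₗ-irrefl y (subst (y <ₗ_) (maximal b b∈ y∣b) y<b)

  lexTop-unique : ∀ {y y′ u} → y ∈ Γ → y′ ∈ Γ → IsLexTop y u → IsLexTop y′ u → y ≡ y′
  lexTop-unique {y} {y′} y∈ y′∈ (_ , u∣y , highest) (_ , u∣y′ , highest′) with <ₗ-compare y y′
  ... | tri< y<y′ _ _ = ⊥-elim (highest y′ y′∈ u∣y′ y<y′)
  ... | tri≈ _ y≡y′ _ = y≡y′
  ... | tri> _ _ y′<y = ⊥-elim (highest′ y y∈ u∣y y′<y)

  extend : ∀ {u} → u ∈ Γ → Σ (Monomial r) λ β → IsMaximal Γ β × u ∣ₘ β
  extend u∈ with lexTop u∈
  ... | β , β∈ , top = β , lexTop-maximal β∈ top , proj₁ (proj₂ top)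

  maximal-by-degree : ∀ {β b} → IsMaximal Γ β → b ∈ Γ → deg β ≤ deg b → IsMaximal Γ b
  maximal-by-degree {β} {b} β-max b∈ deg-β≤b = b∈ , above
    where
    above : ∀ v → v ∈ Γ → b ∣ₘ v → v ≡ b
    above v v∈ b∣v with extend v∈
    ... | βᵥ , βᵥ-max , v∣βᵥ = ∣ₘ-antisym (subst (v ∣ₘ_) (sym b≡βᵥ) v∣βᵥ) b∣v
      where
      b≡βᵥ : b ≡ βᵥ
      b≡βᵥ = divisor-of-degree b βᵥ (λ k → ≤-trans (b∣v k) (v∣βᵥ k))
               (≤-trans (≤-reflexive (pure βᵥ β βᵥ-max β-max)) deg-β≤b)

  -- excess β β′ = Σₖ (βₖ − β′ₖ)₊ measures how far β is from dividing β′.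
  excess : Monomial r → Monomial r → ℕ
  excess β β′ = deg (β /ₘ β′)

  exchange-step : ∀ c {β β′} → IsMaximal Γ β → IsMaximal Γ β′ → c ∣ₘ β → ∀ l →
    lookup c l < lookup β l → lookup β′ l < lookup β l →
    Σ (Monomial r) λ β″ → IsMaximal Γ β″ × c ∣ₘ β″ × excess β″ β′ < excess β β′
  exchange-step c {β} {β′} β-max β′-max c∣β l cₗ<βₗ β′ₗ<βₗ with exchange β β′ β-max β′-max l β′ₗ<βₗ
  ... | j , βⱼ<β′ⱼ , β″∈ = exch l j β , β″-max , c∣β″ , closer
    where
    l≢j : l ≢ j
    l≢j refl = <-asym βⱼ<β′ⱼ β′ₗ<βₗ
    β″-max : IsMaximal Γ (exch l j β)
    β″-max = maximal-by-degree β-max β″∈ (≤-reflexive (sym (deg-exch β l j (≤-trans (s≤s z≤n) cₗ<βₗ))))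
    c∣β″ : c ∣ₘ exch l j β
    c∣β″ k with l Fin.≟ k | j Fin.≟ k
    ... | yes refl | _ = subst (lookup c l ≤_) (sym (exch-l β l≢j)) (pred-mono-≤ cₗ<βₗ)
    ... | no _ | yes refl = subst (lookup c j ≤_) (sym (exch-j β l≢j)) (m≤n⇒m≤1+n (c∣β j))
    ... | no l≢k | no j≢k = subst (lookup c k ≤_) (sym (exch-other β l≢k j≢k)) (c∣β k)
    lookup-/ : ∀ v k → lookup (v /ₘ β′) k ≡ lookup v k ∸ lookup β′ k
    lookup-/ v k = Vec.lookup-zipWith _∸_ k v β′
    pred-∸-< : ∀ {m n} → n < m → pred m ∸ n < m ∸ n
    pred-∸-< {suc m} n<m = ∸-monoˡ-< ≤-refl (≤-pred n<m)
    excess-∣ : exch l j β /ₘ β′ ∣ₘ β /ₘ β′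
    excess-∣ k rewrite lookup-/ (exch l j β) k | lookup-/ β k with l Fin.≟ k | j Fin.≟ k
    ... | yes refl | _ rewrite exch-l β l≢j = ∸-monoˡ-≤ (lookup β′ l) pred[n]≤n
    ... | no _ | yes refl rewrite exch-j β l≢j | m≤n⇒m∸n≡0 βⱼ<β′ⱼ = z≤n
    ... | no l≢k | no j≢k rewrite exch-other β l≢k j≢k = ≤-refl
    drop-at-l : lookup (exch l j β /ₘ β′) l < lookup (β /ₘ β′) l
    drop-at-l rewrite lookup-/ (exch l j β) l | lookup-/ β l | exch-l β l≢j = pred-∸-< β′ₗ<βₗ
    closer : excess (exch l j β) β′ < excess β β′
    closer = deg-strict (exch l j β /ₘ β′) (β /ₘ β′) excess-∣ l drop-at-l

  -- Search among maximal β above c, moving β towards a maximal β′ above c′ by exchanges;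
  -- when neither a raise nor an exchange is possible, stuck-degree-bound forces deg c′ ≤ deg c.
  augmentation : ∀ {c c′} → c ∈ Γ → c′ ∈ Γ → deg c < deg c′ →
    Σ (Fin r) λ k → lookup c k < lookup c′ k × x[ k ]* c ∈ Γ
  augmentation {c} {c′} c∈ c′∈ deg-c<c′ with extend c∈ | extend c′∈
  ... | β₀ , β₀-max , c∣β₀ | β′ , β′-max , c′∣β′ =
    search (suc (excess β₀ β′)) β₀ β₀-max c∣β₀ ≤-refl
    where
    search : ∀ n β → IsMaximal Γ β → c ∣ₘ β → excess β β′ < n →
      Σ (Fin r) λ k → lookup c k < lookup c′ k × x[ k ]* c ∈ Γ
    search zero β _ _ ()
    search (suc n) β β-max c∣β bound
      with Fin.any? (λ k → (lookup c k <? lookup β k) ×-dec (lookup c k <? lookup c′ k))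
    ... | yes (k , cₖ<βₖ , cₖ<c′ₖ) = k , cₖ<c′ₖ , down (proj₁ β-max) (x*-∣ k c β cₖ<βₖ (λ j _ → c∣β j))
    ... | no cannot-raise
      with Fin.any? (λ l → (lookup c l <? lookup β l) ×-dec (lookup β′ l <? lookup β l))
    ...   | yes (l , cₗ<βₗ , β′ₗ<βₗ) with exchange-step c β-max β′-max c∣β l cₗ<βₗ β′ₗ<βₗ
    ...     | β″ , β″-max , c∣β″ , closer = search n β″ β″-max c∣β″ (<-≤-trans closer (≤-pred bound))
    search (suc n) β β-max c∣β bound | no cannot-raise | no cannot-exchange = ⊥-elim (<⇒≱ deg-c<c′ stuck)
      where
      stuck : deg c′ ≤ deg c
      stuck = +-cancelʳ-≤ (deg β) (deg c′) (deg c)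
        (subst (deg c′ + deg β ≤_) (cong (deg c +_) (pure β′ β β′-max β-max))
          (stuck-degree-bound c c′ β β′ c∣β c′∣β′ λ k cₖ<βₖ →
            ≮⇒≥ (λ c′ₖ>cₖ → cannot-raise (k , cₖ<βₖ , c′ₖ>cₖ)) ,
            ≮⇒≥ (λ β′ₖ<βₖ → cannot-exchange (k , cₖ<βₖ , β′ₖ<βₖ))))

  augment-until : ∀ {c₀ M} B → c₀ ∈ Γ → M ∈ Γ → c₀ ∣ₘ B → M ∣ₘ B →
    Σ (Monomial r) λ c → c ∈ Γ × c₀ ∣ₘ c × c ∣ₘ B × deg M ≤ deg c
  augment-until {c₀} {M} B c₀∈ M∈ c₀∣B M∣B = go (deg M) c₀ c₀∈ (∣ₘ-refl c₀) c₀∣B (m≤m+n (deg M) (deg c₀))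
    where
    go : ∀ n c → c ∈ Γ → c₀ ∣ₘ c → c ∣ₘ B → deg M ≤ n + deg c →
      Σ (Monomial r) λ c → c ∈ Γ × c₀ ∣ₘ c × c ∣ₘ B × deg M ≤ deg c
    go n c c∈ c₀∣c c∣B bound with deg c <? deg M
    ... | no c≮M = c , c∈ , c₀∣c , c∣B , ≮⇒≥ c≮M
    go zero c c∈ c₀∣c c∣B bound | yes c<M = ⊥-elim (<⇒≱ c<M bound)
    go (suc n) c c∈ c₀∣c c∣B bound | yes c<M with augmentation c∈ M∈ c<M
    ... | k , cₖ<Mₖ , xₖc∈ = go n (x[ k ]* c) xₖc∈ (λ j → ≤-trans (c₀∣c j) (∣-x* k c j))
            (x*-∣ k c B (<-≤-trans cₖ<Mₖ (M∣B k)) (λ j _ → c∣B j))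
            (subst (deg M ≤_) (trans (sym (+-suc n (deg c))) (cong (n +_) (sym (deg-x* k c)))) bound)

  -- Augment c₀ = x_i gcd(a, a′) inside x_i M up to degree deg M; the result c misses x_i M in at
  -- most one coordinate k, and whichever of a, a′ realises the gcd at k can be raised below c.
  raise-gcd : ∀ i {a a′ M} → M ∈ Γ → a ∣ₘ M → a′ ∣ₘ M →
    lookup a i ≡ lookup M i → lookup a′ i ≡ lookup M i →
    x[ i ]* (a ∧ₘ a′) ∈ Γ → x[ i ]* a ∈ Γ ⊎ x[ i ]* a′ ∈ Γ
  raise-gcd i {a} {a′} {M} M∈ a∣M a′∣M aᵢ≡Mᵢ a′ᵢ≡Mᵢ c₀∈ =
    finish (augment-until (x[ i ]* M) c₀∈ M∈ (x*-mono i (a ∧ₘ a′) M gcd∣M) (∣-x* i M))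
    where
    c₀ : Monomial r
    c₀ = x[ i ]* (a ∧ₘ a′)
    gcd∣M : a ∧ₘ a′ ∣ₘ M
    gcd∣M k = ≤-trans (∧ₘ-∣ˡ a a′ k) (a∣M k)
    c₀ᵢ≡ : ∀ b → lookup b i ≡ lookup M i → lookup c₀ i ≡ suc (lookup b i)
    c₀ᵢ≡ b bᵢ≡Mᵢ = begin
      lookup c₀ i                      ≡⟨ x*-here i (a ∧ₘ a′) ⟩
      suc (lookup (a ∧ₘ a′) i)         ≡⟨ cong suc (Vec.lookup-zipWith _⊓_ i a a′) ⟩
      suc (lookup a i ⊓ lookup a′ i)   ≡⟨ cong suc (cong₂ _⊓_ aᵢ≡Mᵢ a′ᵢ≡Mᵢ) ⟩
      suc (lookup M i ⊓ lookup M i)    ≡⟨ cong suc (⊓-idem (lookup M i)) ⟩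
      suc (lookup M i)                 ≡⟨ cong suc (sym bᵢ≡Mᵢ) ⟩
      suc (lookup b i)                 ∎
      where open ≡-Reasoning
    raise-below : ∀ c b → b ∣ₘ M → lookup b i ≡ lookup M i → c₀ ∣ₘ c → ∀ k → lookup b k ≤ lookup c k →
      (∀ j → k ≢ j → lookup (x[ i ]* M) j ≤ lookup c j) → x[ i ]* b ∣ₘ c
    raise-below c b b∣M bᵢ≡Mᵢ c₀∣c k bₖ≤cₖ agree =
      x*-∣ i b c (subst (_≤ lookup c i) (c₀ᵢ≡ b bᵢ≡Mᵢ) (c₀∣c i)) others
      where
      others : ∀ j → i ≢ j → lookup b j ≤ lookup c j
      others j i≢j with k Fin.≟ j
      ... | yes refl = bₖ≤cₖ
      ... | no k≢j = ≤-trans (b∣M j) (subst (_≤ lookup c j) (x*-there M i≢j) (agree j k≢j))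
    min-fits : ∀ c → c₀ ∣ₘ c → ∀ k b → lookup a k ⊓ lookup a′ k ≡ lookup b k → lookup b k ≤ lookup c k
    min-fits c c₀∣c k b min≡bₖ = subst (_≤ lookup c k) (trans (Vec.lookup-zipWith _⊓_ k a a′) min≡bₖ)
      (≤-trans (∣-x* i (a ∧ₘ a′) k) (c₀∣c k))
    raise-at : ∀ c → c ∈ Γ → c₀ ∣ₘ c → ∀ k → (∀ j → k ≢ j → lookup (x[ i ]* M) j ≤ lookup c j) →
      x[ i ]* a ∈ Γ ⊎ x[ i ]* a′ ∈ Γ
    raise-at c c∈ c₀∣c k agree with ⊓-sel (lookup a k) (lookup a′ k)
    ... | inj₁ min≡a = inj₁ (down c∈ (raise-below c a a∣M aᵢ≡Mᵢ c₀∣c k (min-fits c c₀∣c k a min≡a) agree))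
    ... | inj₂ min≡a′ = inj₂ (down c∈ (raise-below c a′ a′∣M a′ᵢ≡Mᵢ c₀∣c k (min-fits c c₀∣c k a′ min≡a′) agree))
    finish : (Σ (Monomial r) λ c → c ∈ Γ × c₀ ∣ₘ c × c ∣ₘ x[ i ]* M × deg M ≤ deg c) →
      x[ i ]* a ∈ Γ ⊎ x[ i ]* a′ ∈ Γ
    finish (c , c∈ , c₀∣c , c∣xᵢM , deg-M≤c)
      with almost-equal c (x[ i ]* M) c∣xᵢM (subst (_≤ suc (deg c)) (sym (deg-x* i M)) (s≤s deg-M≤c))
    ... | inj₁ xᵢM∣c = raise-at c c∈ c₀∣c i (λ j _ → xᵢM∣c j)
    ... | inj₂ (k , agree) = raise-at c c∈ c₀∣c k agree

  raise-splice-∉ : ∀ {y u} i → IsLexTop y u → x[ i ]* splice y i u ∉ Γ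
  raise-splice-∉ {y} {u} i (_ , u∣y , highest) raised∈ =
    highest (x[ i ]* splice y i u) raised∈ (λ k → ≤-trans (∣-splice i u∣y k) (∣-x* i (splice y i u) k))
      (<ₗ-x*-splice y i u)

  -- The fiber {u | IsLexTop y u} is closed under gcd. If b ∈ Γ were above gcd(u, v) with
  -- y <ₗ b first differing at i, raise-gcd (with M = y) would raise splice y i u or splice y i v inside Γ.
  lexTop-gcd : ∀ {y u v} → y ∈ Γ → IsLexTop y u → IsLexTop y v → IsLexTop y (u ∧ₘ v)
  lexTop-gcd {y} {u} {v} y∈ top-u@(u∈ , u∣y , _) top-v@(_ , v∣y , _) =
    down u∈ (∧ₘ-∣ˡ u v) , (λ k → ≤-trans (∧ₘ-∣ˡ u v k) (u∣y k)) , nothing-higher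
    where
    nothing-higher : ∀ b → b ∈ Γ → u ∧ₘ v ∣ₘ b → ¬ y <ₗ b
    nothing-higher b b∈ uv∣b y<b with <ₗ-first-difference y<b
    ... | i , agree , yᵢ<bᵢ
      with raise-gcd i y∈ (splice-∣ i u∣y) (splice-∣ i v∣y) (splice-≤ y i u i ≤-refl) (splice-≤ y i v i ≤-refl)
             (down b∈ (subst (λ w → x[ i ]* w ∣ₘ b) (sym (splice-gcd y i u v))
               (raise-splice-∣ y b i (u ∧ₘ v) agree yᵢ<bᵢ uv∣b)))
    ...   | inj₁ raised-u∈ = raise-splice-∉ i top-u raised-u∈
    ...   | inj₂ raised-v∈ = raise-splice-∉ i top-v raised-v∈

  IsLexTop? : ∀ y u → Dec (IsLexTop y u)
  IsLexTop? y u = (u ∈? Γ) ×-dec (u ∣ₘ? y) ×-dec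
    map′ (λ all b b∈ → All.lookup all b∈) (λ highest → All.tabulate λ {b} → highest b)
      (All.all? (λ b → (u ∣ₘ? b) →-dec ¬? (y LexOrder.<? b)) Γ)
    where open import Data.List.Membership.DecPropositional (Vec.≡-dec _≟_) using (_∈?_)

  -- The least element of the fiber of y: the gcd of all u ∈ Γ whose lexicographic top is y.
  bottom : Monomial r → Monomial r
  bottom y = gcd-all y (filter (IsLexTop? y) Γ)

  bottom-lexTop : ∀ {y} → IsMaximal Γ y → IsLexTop y (bottom y)
  bottom-lexTop {y} y-max =
    gcds (filter (IsLexTop? y) Γ) (All.tabulate (λ u∈ → proj₂ (∈-filter⁻ (IsLexTop? y) {xs = Γ} u∈)))
    where
    gcds : ∀ us → All (IsLexTop y) us → IsLexTop y (gcd-all y us)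
    gcds [] [] = maximal-lexTop y-max
    gcds (u ∷ us) (top ∷ tops) = lexTop-gcd (proj₁ y-max) top (gcds us tops)

  fiber⇒interval : ∀ {y u} → IsLexTop y u → InInterval Γ (bottom y , y) u
  fiber⇒interval {y} top@(u∈ , u∣y , _) = u∈ , gcd-all-∣ y (∈-filter⁺ (IsLexTop? y) u∈ top) , u∣y

  interval⇒fiber : ∀ {y u} → IsMaximal Γ y → InInterval Γ (bottom y , y) u → IsLexTop y u
  interval⇒fiber y-max (u∈ , bottom∣u , u∣y) =
    u∈ , u∣y , λ b b∈ u∣b → proj₂ (proj₂ (bottom-lexTop y-max)) b b∈ (λ k → ≤-trans (bottom∣u k) (u∣b k))

  maximals : List (Monomial r)
  maximals = sortDesc (filter (λ y → IsLexTop? y y) Γ)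

  maximals-∈⁻ : ∀ {y} → y ∈ maximals → IsMaximal Γ y
  maximals-∈⁻ y∈ with ∈-filter⁻ (λ y → IsLexTop? y y) {xs = Γ} (sortDesc-∈⁻ _ y∈)
  ... | y∈Γ , top = lexTop-maximal y∈Γ top

  maximals-∈⁺ : ∀ {y} → IsMaximal Γ y → y ∈ maximals
  maximals-∈⁺ y-max = sortDesc-∈⁺ _ (∈-filter⁺ (λ y → IsLexTop? y y) (proj₁ y-max) (maximal-lexTop y-max))

  fiberInterval : Monomial r → Monomial r × Monomial r
  fiberInterval y = bottom y , y

  shellingIntervals : List (Monomial r × Monomial r)
  shellingIntervals = List.map fiberInterval maximals

  Position : Set
  Position = Fin (length shellingIntervals)

  listed : ∀ k → Σ (Monomial r) λ y → IsMaximal Γ y × List.lookup shellingIntervals k ≡ fiberInterval y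
  listed k with ∈-map⁻ fiberInterval (∈-lookup k)
  ... | y , y∈ , eq = y , maximals-∈⁻ y∈ , eq

  position : ∀ {u} → u ∈ Γ →
    Σ Position λ k → Σ (Monomial r) λ y → y ∈ Γ × IsLexTop y u × List.lookup shellingIntervals k ≡ fiberInterval y
  position u∈ with lexTop u∈
  ... | y , y∈ , top = Any.index y-listed , y , y∈ , top , sym (lookup-index y-listed)
    where
    y-listed : fiberInterval y ∈ shellingIntervals
    y-listed = ∈-map⁺ fiberInterval (maximals-∈⁺ (lexTop-maximal y∈ top))

  tops-decreasing : AllPairs (λ p q → proj₂ q <ₗ proj₂ p) shellingIntervals
  tops-decreasing = AllPairs.map⁺ (sortDesc-decreasing (filter (λ y → IsLexTop? y y) Γ))

  IsShellingInterval : Monomial r × Monomial r → Set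
  IsShellingInterval (x , y) = x ∈ Γ × IsMaximal Γ y × x ∣ₘ y × IsMPoset (InInterval Γ (x , y))

  fiberInterval-valid : ∀ {y} → IsMaximal Γ y → IsShellingInterval (fiberInterval y)
  fiberInterval-valid {y} y-max with bottom-lexTop y-max
  ... | bottom∈ , bottom∣y , _ =
    bottom∈ , y-max , bottom∣y , interval-isMPoset Γ closed (bottom y) (proj₁ y-max) bottom∣y

  -- Fibers partition Γ, so each u ∈ Γ lies in exactly one listed interval.
  unique-position : ∀ u → u ∈ Γ → ∃[ k ] (InInterval Γ (List.lookup shellingIntervals k) u ×
    (∀ k′ → InInterval Γ (List.lookup shellingIntervals k′) u → k′ ≡ k))
  unique-position u u∈ with position u∈
  ... | k , y , y∈ , top , at-k = k , subst (λ p → InInterval Γ p u) (sym at-k) (fiber⇒interval top) , only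
    where
    only : ∀ k′ → InInterval Γ (List.lookup shellingIntervals k′) u → k′ ≡ k
    only k′ in-k′ with listed k′
    ... | y′ , y′-max , at-k′ = AllPairs-position tops-decreasing proj₂ <ₗ⇒≢ k′ k
      (trans (cong proj₂ at-k′) (trans y′≡y (sym (cong proj₂ at-k))))
      where
      y′≡y : y′ ≡ y
      y′≡y = lexTop-unique (proj₁ y′-max) y∈
        (interval⇒fiber y′-max (subst (λ p → InInterval Γ p u) at-k′ in-k′)) top
      <ₗ⇒≢ : ∀ (p q : Monomial r × Monomial r) → proj₂ q <ₗ proj₂ p → proj₂ p ≢ proj₂ q
      <ₗ⇒≢ p q q<p p≡q = <ₗ-irrefl (proj₂ p) (subst (_<ₗ proj₂ p) (sym p≡q) q<p)

  -- A divisor v ∈ Γ of an element u of the k-th interval lies in an interval at a position ≤ k: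
  -- the lexicographic top of v is at least the top y of u, since v ∣ u ∣ y.
  divisor-position : ∀ {u v} k → InInterval Γ (List.lookup shellingIntervals k) u → v ∈ Γ → v ∣ₘ u →
    Σ Position λ kᵥ → toℕ kᵥ ≤ toℕ k × InInterval Γ (List.lookup shellingIntervals kᵥ) v
  divisor-position {u} {v} k in-k v∈ v∣u with listed k | position v∈
  ... | y , y-max , at-k | kᵥ , yᵥ , _ , topᵥ , at-kᵥ =
    kᵥ , not-later , subst (λ p → InInterval Γ p v) (sym at-kᵥ) (fiber⇒interval topᵥ)
    where
    u∣y : u ∣ₘ y
    u∣y = proj₂ (proj₂ (subst (λ p → InInterval Γ p u) at-k in-k))
    not-later : toℕ kᵥ ≤ toℕ k
    not-later = ≮⇒≥ λ k<kᵥ → proj₂ (proj₂ topᵥ) y (proj₁ y-max) (λ j → ≤-trans (v∣u j) (u∣y j))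
      (subst₂ _<ₗ_ (cong proj₂ at-kᵥ) (cong proj₂ at-k) (AllPairs-lookup tops-decreasing k kᵥ k<kᵥ))

  initial-unions-closed : ∀ n u v → InUnion Γ (take n shellingIntervals) u → v ∈ Γ → v ∣ₘ u →
    InUnion Γ (take n shellingIntervals) v
  initial-unions-closed n u v (k , in-k) v∈ v∣u with lookup-take⁻ n shellingIntervals k
  ... | k₁ , k₁<n , at-k₁ with divisor-position k₁ (subst (λ p → InInterval Γ p u) at-k₁ in-k) v∈ v∣u
  ...   | kᵥ , kᵥ≤k₁ , in-kᵥ with lookup-take⁺ n shellingIntervals kᵥ (≤-<-trans kᵥ≤k₁ k₁<n)
  ...     | k′ , at-k′ = k′ , subst (λ p → InInterval Γ p v) (sym at-k′) in-kᵥ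

  shelling : IsMShelling Γ shellingIntervals
  shelling = valid , unique-position , initial-unions-closed
    where
    valid : ∀ k → IsShellingInterval (List.lookup shellingIntervals k)
    valid k with listed k
    ... | y , y-max , at-k = subst IsShellingInterval (sym at-k) (fiberInterval-valid y-max)

corollary2p2 : (h : ℕ → ℕ) → IsPMVector h → IsShellableMVector h
corollary2p2 h (r , Γ , ((unique , closed) , pure , exchange) , degSeq≡h) =
  r , Γ , (unique , closed) , pure , (shellingIntervals , shelling) , degSeq≡h
  where open Polymatroid Γ closed pure exchange
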